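{- Let $a$ and $b$ be relatively prime integers with $1\le a<b$. Then there exist an integer $n$ and a permutation $\pi=(\pi_1,\ldots,\pi_n)$ of $\{1,2,\ldots,n\}$ such that $\{\pi_{i+1}-\pi_i : 1\le i\le n-1\}=\{a,-b\}$, i.e., $(a,-b)$ is a $D$-pair.
   Context: A pair $(p,q)$ of distinct integers is called a $D$-pair if for some $n\ge 1$ there is a permutation $\pi$ of $\{1,\ldots,n\}$ whose set of discrete derivative values $\{\pi_{i+1}-\pi_i : i\le n-1\}$ equals $\{p,q\}$. -}

module Defs where

open import Data.Nat using (ℕ; suc)
open import Data.Fin using (Fin; toℕ; inject₁)
open import Data.Integer using (ℤ; +_; _-_)
open import Data.Product using (Σ; ∃; ∃-syntax; _×_)
open import Data.Sum using (_⊎_)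
open import Data.Fin.Permutation using (Permutation; _⟨$⟩ʳ_)
open import Relation.Binary.PropositionalEquality using (_≡_)
open import Relation.Nullary using (¬_)

-- A permutation π of {1,…,n} is given as a bijection Fin n → Fin n;
-- the value π_i (1-based) is  toℕ (π ⟨$⟩ i) + 1 , and the index i ranges over Fin n.
-- Differences of values are independent of the +1 shift.
value : ∀ {n} → Permutation n n → Fin n → ℤ
value π i = + suc (toℕ (π ⟨$⟩ʳ i))

deriv : ∀ {m} → Permutation (suc m) (suc m) → Fin m → ℤ
deriv π i = value π (Fin.suc i) - value π (inject₁ i)

DerivSetIs : ∀ {m} → Permutation (suc m) (suc m) → ℤ → ℤ → Set
DerivSetIs {m} π p q =
  ((i : Fin m) → (deriv π i ≡ p) ⊎ (deriv π i ≡ q))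
  × (∃[ i ] deriv π i ≡ p)
  × (∃[ j ] deriv π j ≡ q)

DPair : ℤ → ℤ → Set
DPair p q = ¬ (p ≡ q) × (∃[ m ] Σ (Permutation (suc m) (suc m)) λ π → DerivSetIs π p q)

-- With N = a + b, list the residues (k + 1)·a mod N for k = 0, …, N − 1. Adding a modulo N
-- to a residue r < N is r + a when r < b and r − b otherwise, so consecutive terms differ by
-- a or by −b. Since gcd(a, N) = gcd(a, b) = 1 the N terms are pairwise distinct, i.e. the list
-- is a permutation of {0, …, N − 1}; it ends with N·a mod N = 0, so the nonzero values a < b
-- and b occur before the last position, and both differences a and −b are realised.
module Submission where

open import Defs
open import Data.Nat using (ℕ; _≤_; _<_)
open import Data.Nat.Coprimality using (Coprime)
open import Data.Integer using (+_; -_)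

open import Data.Fin as Fin using (Fin; toℕ; fromℕ<; inject₁; punchOut)
open import Data.Fin.Permutation using (Permutation; permutation; _⟨$⟩ʳ_; _⟨$⟩ˡ_; inverseʳ)
open import Data.Fin.Properties
  using ( any?; injective⇒≤; punchOut-injective; toℕ<n; toℕ-injective
        ; toℕ-fromℕ<; fromℕ<-injective; toℕ-inject₁ )
  renaming (_≟_ to _≟ᶠ_)
open import Data.Integer using (_⊖_)
open import Data.Integer.Properties using ([+m]-[+n]≡m⊖n; [1+m]⊖[1+n]≡m⊖n; ⊖-≥; ⊖-≤)
open import Data.Nat using (suc; _+_; _*_; _∸_; _%_; _/_; NonZero; _<?_; z<s; s≤s⁻¹)
open import Data.Nat.Coprimality using (coprime-+; coprime-divisor) renaming (sym to coprime-sym)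
open import Data.Nat.Divisibility using (_∣_; divides; m∣m*n; n∣m⇒m%n≡0)
open import Data.Nat.DivMod
  using (m≡m%n+[m/n]*n; m%n%n≡m%n; %-distribˡ-+; [m+n]%n≡m%n; m<n⇒m%n≡m; m%n<n)
open import Data.Nat.Properties
open import Algebra.Properties.CommutativeSemigroup +-commutativeSemigroup using (x∙yz≈y∙xz)
open import Data.Product using (∃; _×_; _,_; proj₁; proj₂)
open import Data.Sum as Sum using (_⊎_; inj₁; inj₂; [_,_]′)
open import Function using (_∘_)
open import Function.Definitions using (Injective)
open import Relation.Binary.PropositionalEquality
open import Relation.Nullary using (yes; no; contradiction)

injective⇒surjective : ∀ {n} {f : Fin n → Fin n} → Injective _≡_ _≡_ f →
                       ∀ y → ∃ λ x → f x ≡ y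
injective⇒surjective {suc n} {f} f-inj y with any? (λ x → f x ≟ᶠ y)
... | yes found = found
... | no y∉image = contradiction (injective⇒≤ avoid-y-injective) 1+n≰n
  where
  f≢y : ∀ x → y ≢ f x
  f≢y x e = y∉image (x , sym e)

  avoid-y : Fin (suc n) → Fin n
  avoid-y x = punchOut (f≢y x)

  avoid-y-injective : Injective _≡_ _≡_ avoid-y
  avoid-y-injective {x} {z} = f-inj ∘ punchOut-injective (f≢y x) (f≢y z)

permutationOfInjection : ∀ {n} (f : Fin n → Fin n) → Injective _≡_ _≡_ f → Permutation n n
permutationOfInjection f f-inj =
  permutation f (proj₁ ∘ surj) (proj₂ ∘ surj) (λ x → f-inj (proj₂ (surj (f x))))
  where surj = injective⇒surjective f-inj

[m+n%d]%d≡[m+n]%d : ∀ m n d .{{_ : NonZero d}} → (m + n % d) % d ≡ (m + n) % d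
[m+n%d]%d≡[m+n]%d m n d = begin
  (m + n % d) % d           ≡⟨ %-distribˡ-+ m (n % d) d ⟩
  (m % d + n % d % d) % d   ≡⟨ cong (λ r → (m % d + r) % d) (m%n%n≡m%n n d) ⟩
  (m % d + n % d) % d       ≡⟨ %-distribˡ-+ m n d ⟨
  (m + n) % d               ∎
  where open ≡-Reasoning

%-≡⇒∣∸ : ∀ m n d .{{_ : NonZero d}} → m % d ≡ n % d → d ∣ n ∸ m
%-≡⇒∣∸ m n d m%d≡n%d = divides (n / d ∸ m / d) (begin
  n ∸ m
    ≡⟨ cong₂ _∸_ (m≡m%n+[m/n]*n n d) (m≡m%n+[m/n]*n m d) ⟩
  (n % d + n / d * d) ∸ (m % d + m / d * d)
    ≡⟨ cong (λ r → (n % d + n / d * d) ∸ (r + m / d * d)) m%d≡n%d ⟩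
  (n % d + n / d * d) ∸ (n % d + m / d * d)
    ≡⟨ [m+n]∸[m+o]≡n∸o (n % d) _ _ ⟩
  n / d * d ∸ m / d * d
    ≡⟨ *-distribʳ-∸ d (n / d) (m / d) ⟨
  (n / d ∸ m / d) * d
    ∎)
  where open ≡-Reasoning

∣∧<⇒≡0 : ∀ {m n} .{{_ : NonZero n}} → n ∣ m → m < n → m ≡ 0
∣∧<⇒≡0 {m} {n} n∣m m<n = trans (sym (m<n⇒m%n≡m m<n)) (n∣m⇒m%n≡0 m n n∣m)

module Orbit (a b : ℕ) .{{_ : NonZero (a + b)}} where

  orbit : ℕ → ℕ
  orbit k = suc k * a % (a + b)

  orbit-< : ∀ k → orbit k < a + b
  orbit-< k = m%n<n (suc k * a) (a + b)

  orbit-suc : ∀ k → orbit (suc k) ≡ (a + orbit k) % (a + b)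
  orbit-suc k = sym ([m+n%d]%d≡[m+n]%d a (suc k * a) (a + b))

  orbit-last : ∀ m → suc m ≡ a + b → orbit m ≡ 0
  orbit-last m 1+m≡a+b = begin
    suc m * a % (a + b)       ≡⟨ cong (λ n → n * a % (a + b)) 1+m≡a+b ⟩
    (a + b) * a % (a + b)     ≡⟨ n∣m⇒m%n≡0 ((a + b) * a) (a + b) (m∣m*n a) ⟩
    0                         ∎
    where open ≡-Reasoning

  [a+r]%[a+b]≡a+r : ∀ {r} → r < b → (a + r) % (a + b) ≡ a + r
  [a+r]%[a+b]≡a+r r<b = m<n⇒m%n≡m (+-monoʳ-< a r<b)

  [a+r]%[a+b]≡r∸b : ∀ {r} → b ≤ r → r < a + b → (a + r) % (a + b) ≡ r ∸ b
  [a+r]%[a+b]≡r∸b {r} b≤r r<a+b = begin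
    (a + r) % (a + b)             ≡⟨ cong (λ s → (a + s) % (a + b)) (m∸n+n≡m b≤r) ⟨
    (a + (r ∸ b + b)) % (a + b)   ≡⟨ cong (_% (a + b)) (x∙yz≈y∙xz a (r ∸ b) b) ⟩
    (r ∸ b + (a + b)) % (a + b)   ≡⟨ [m+n]%n≡m%n (r ∸ b) (a + b) ⟩
    (r ∸ b) % (a + b)             ≡⟨ m<n⇒m%n≡m (≤-<-trans (m∸n≤m r b) r<a+b) ⟩
    r ∸ b                         ∎
    where open ≡-Reasoning

  orbit-suc-< : ∀ k → orbit k < b → orbit (suc k) ≡ a + orbit k
  orbit-suc-< k r<b = trans (orbit-suc k) ([a+r]%[a+b]≡a+r r<b)

  orbit-suc-≥ : ∀ k → b ≤ orbit k → orbit (suc k) ≡ orbit k ∸ b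
  orbit-suc-≥ k b≤r = trans (orbit-suc k) ([a+r]%[a+b]≡r∸b b≤r (orbit-< k))

  orbit-step-< : ∀ k → orbit k < b → orbit (suc k) ⊖ orbit k ≡ + a
  orbit-step-< k r<b = begin
    orbit (suc k) ⊖ orbit k   ≡⟨ cong (_⊖ orbit k) (orbit-suc-< k r<b) ⟩
    (a + orbit k) ⊖ orbit k   ≡⟨ ⊖-≥ (m≤n+m (orbit k) a) ⟩
    + (a + orbit k ∸ orbit k) ≡⟨ cong +_ (m+n∸n≡m a (orbit k)) ⟩
    + a                       ∎
    where open ≡-Reasoning

  orbit-step-≥ : ∀ k → b ≤ orbit k → orbit (suc k) ⊖ orbit k ≡ - + b
  orbit-step-≥ k b≤r = begin
    orbit (suc k) ⊖ orbit k          ≡⟨ cong (_⊖ orbit k) (orbit-suc-≥ k b≤r) ⟩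
    (orbit k ∸ b) ⊖ orbit k          ≡⟨ ⊖-≤ (m∸n≤m (orbit k) b) ⟩
    - + (orbit k ∸ (orbit k ∸ b))    ≡⟨ cong (-_ ∘ +_) (m∸[m∸n]≡n b≤r) ⟩
    - + b                            ∎
    where open ≡-Reasoning

  orbit-step : ∀ k → orbit (suc k) ⊖ orbit k ≡ + a ⊎ orbit (suc k) ⊖ orbit k ≡ - + b
  orbit-step k with orbit k <? b
  ... | yes r<b = inj₁ (orbit-step-< k r<b)
  ... | no  r≮b = inj₂ (orbit-step-≥ k (≮⇒≥ r≮b))

  module _ (cop : Coprime a b) where

    orbit-injective-≤ : ∀ {i j} → i ≤ j → j < a + b → orbit i ≡ orbit j → i ≡ j
    orbit-injective-≤ {i} {j} i≤j j<a+b orbitᵢ≡orbitⱼ =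
      ≤-antisym i≤j (m∸n≡0⇒m≤n j∸i≡0)
      where
      a+b∣[j∸i]*a : a + b ∣ (j ∸ i) * a
      a+b∣[j∸i]*a = subst (a + b ∣_) (sym (*-distribʳ-∸ a (suc j) (suc i)))
                          (%-≡⇒∣∸ (suc i * a) (suc j * a) (a + b) orbitᵢ≡orbitⱼ)

      a+b∣j∸i : a + b ∣ j ∸ i
      a+b∣j∸i = coprime-divisor (coprime-+ (coprime-sym cop))
                                (subst (a + b ∣_) (*-comm (j ∸ i) a) a+b∣[j∸i]*a)

      j∸i≡0 : j ∸ i ≡ 0
      j∸i≡0 = ∣∧<⇒≡0 a+b∣j∸i (≤-<-trans (m∸n≤m j i) j<a+b)

    orbit-injective : ∀ {i j} → i < a + b → j < a + b → orbit i ≡ orbit j → i ≡ j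
    orbit-injective {i} {j} i<a+b j<a+b e =
      [ (λ i≤j → orbit-injective-≤ i≤j j<a+b e)
      , (λ j≤i → sym (orbit-injective-≤ j≤i i<a+b (sym e))) ]′ (≤-total i j)

    orbitPermutation : Permutation (a + b) (a + b)
    orbitPermutation =
      permutationOfInjection (λ i → fromℕ< (orbit-< (toℕ i))) fromℕ<-orbit-injective
      where
      fromℕ<-orbit-injective : Injective _≡_ _≡_ (λ i → fromℕ< (orbit-< (toℕ i)))
      fromℕ<-orbit-injective {x} {y} e = toℕ-injective (orbit-injective (toℕ<n x) (toℕ<n y)
        (fromℕ<-injective _ _ (orbit-< (toℕ x)) (orbit-< (toℕ y)) e))

    toℕ-orbitPermutation : ∀ i → toℕ (orbitPermutation ⟨$⟩ʳ i) ≡ orbit (toℕ i)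
    toℕ-orbitPermutation i = toℕ-fromℕ< (orbit-< (toℕ i))

    orbit-surjective : ∀ {v} → v < a + b → ∃ λ k → k < a + b × orbit k ≡ v
    orbit-surjective {v} v<a+b = toℕ x , toℕ<n x , (begin
      orbit (toℕ x)                          ≡⟨ toℕ-orbitPermutation x ⟨
      toℕ (orbitPermutation ⟨$⟩ʳ x)          ≡⟨ cong toℕ (inverseʳ orbitPermutation) ⟩
      toℕ (fromℕ< v<a+b)                     ≡⟨ toℕ-fromℕ< v<a+b ⟩
      v                                      ∎)
      where
      x = orbitPermutation ⟨$⟩ˡ fromℕ< v<a+b
      open ≡-Reasoning

    orbit-hits-before-last : ∀ m → suc m ≡ a + b → ∀ {v} → v ≢ 0 → v < a + b →
                             ∃ λ (i : Fin m) → orbit (toℕ i) ≡ v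
    orbit-hits-before-last m 1+m≡a+b v≢0 v<a+b with orbit-surjective v<a+b
    ... | k , k<a+b , orbitₖ≡v = fromℕ< k<m , trans (cong orbit (toℕ-fromℕ< k<m)) orbitₖ≡v
      where
      k≢m : k ≢ m
      k≢m k≡m = v≢0 (trans (sym orbitₖ≡v) (trans (cong orbit k≡m) (orbit-last m 1+m≡a+b)))

      k<m : k < m
      k<m = ≤∧≢⇒< (s≤s⁻¹ (subst (k <_) (sym 1+m≡a+b) k<a+b)) k≢m

deriv≡⊖ : ∀ {m} (σ : Permutation (suc m) (suc m)) (g : ℕ → ℕ) →
          (∀ i → toℕ (σ ⟨$⟩ʳ i) ≡ g (toℕ i)) →
          ∀ i → deriv σ i ≡ g (suc (toℕ i)) ⊖ g (toℕ i)
deriv≡⊖ σ g σ≡g i = begin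
  deriv σ i                      ≡⟨ [+m]-[+n]≡m⊖n (suc next) (suc this) ⟩
  suc next ⊖ suc this            ≡⟨ [1+m]⊖[1+n]≡m⊖n next this ⟩
  next ⊖ this                    ≡⟨ cong₂ _⊖_ (σ≡g (Fin.suc i)) this≡g ⟩
  g (suc (toℕ i)) ⊖ g (toℕ i)    ∎
  where
  next = toℕ (σ ⟨$⟩ʳ Fin.suc i)
  this = toℕ (σ ⟨$⟩ʳ inject₁ i)
  this≡g : this ≡ g (toℕ i)
  this≡g = trans (σ≡g (inject₁ i)) (cong g (toℕ-inject₁ i))
  open ≡-Reasoning

theorem2p5 : (a b : ℕ) → Coprime a b → 1 ≤ a → a < b → DPair (+ a) (- (+ b))
theorem2p5 a@(suc a′) b@(suc b′) cop _ a<b =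
  (λ ()) , a′ + b , σ , deriv-values , rises , falls
  where
  open Orbit a b

  σ : Permutation (a + b) (a + b)
  σ = orbitPermutation cop

  deriv-orbit : ∀ i → deriv σ i ≡ orbit (suc (toℕ i)) ⊖ orbit (toℕ i)
  deriv-orbit = deriv≡⊖ σ orbit (toℕ-orbitPermutation cop)

  deriv-values : ∀ i → deriv σ i ≡ + a ⊎ deriv σ i ≡ - + b
  deriv-values i = Sum.map (trans (deriv-orbit i)) (trans (deriv-orbit i)) (orbit-step (toℕ i))

  rises : ∃ λ i → deriv σ i ≡ + a
  rises with i , orbitᵢ≡a ← orbit-hits-before-last cop (a′ + b) refl (λ ()) (m<m+n a z<s) =
    i , trans (deriv-orbit i) (orbit-step-< (toℕ i) (subst (_< b) (sym orbitᵢ≡a) a<b))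

  falls : ∃ λ i → deriv σ i ≡ - + b
  falls with i , orbitᵢ≡b ← orbit-hits-before-last cop (a′ + b) refl (λ ()) (m<n+m b z<s) =
    i , trans (deriv-orbit i) (orbit-step-≥ (toℕ i) (≤-reflexive (sym orbitᵢ≡b)))
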